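{- Let $G$ be a graph of order $n$ and let $\Phi$ be a clique cover of $G$. Then \[ I(G\circ 2K_{1};x)=(1+x)^{2n-2|\Phi|}\cdot I(\Phi(G);x), \] where $|\Phi|$ is the number of cliques in $\Phi$.
   Context: All graphs are finite and simple. For a graph $G$, $I(G;x)=\sum_{k\ge0}s_kx^k$ where $s_k$ is the number of independent sets (sets of pairwise non-adjacent vertices) of size $k$. $G\circ 2K_1$ is the graph obtained from $G$ by adding, for each vertex $v$ of $G$, two new non-adjacent vertices joined only to $v$. A clique cover $\Phi$ of $G$ is a spanning subgraph of $G$ each connected component of which is a clique (complete subgraph); equivalently a partition of $V(G)$ into cliques of $G$. The graph $\Phi(G)$ is obtained from $G$ as follows: for each clique $Q\in\Phi$, add two new non-adjacent vertices and join each of them to all the vertices of $Q$ (and to nothing else). -}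

module Defs where

open import Data.Bool using (Bool; true; false; not; _∧_)
open import Data.Bool.ListAction using (and)
open import Data.Nat using (ℕ; zero; suc; _+_; _*_; _∸_; _≡ᵇ_)
open import Data.Nat.Combinatorics using (_C_)
open import Data.Fin using (Fin; splitAt; remQuot; _≟_)
open import Data.Fin.Subset using (Subset; ∣_∣; inside; outside)
open import Data.Vec using (Vec; []; _∷_; lookup)
open import Data.List using (List; []; _∷_; _++_; map; length; filterᵇ; allFin)
open import Data.Product using (_×_; _,_; proj₁; ∃)
open import Data.Sum using (_⊎_; inj₁; inj₂)
open import Function.Definitions using (Surjective)
open import Relation.Binary.PropositionalEquality using (_≡_; refl)
open import Relation.Nullary using (¬_)
open import Relation.Nullary.Decidable using (⌊_⌋)

record Graph : Set where
  field
    order  : ℕ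
    adj    : Fin order → Fin order → Bool
    sym    : ∀ u v → adj u v ≡ adj v u
    irrefl : ∀ v → adj v v ≡ false
open Graph public

allSubsets : (n : ℕ) → List (Subset n)
allSubsets zero    = [] ∷ []
allSubsets (suc n) = map (outside ∷_) (allSubsets n) ++ map (inside ∷_) (allSubsets n)

-- S is independent: no two (distinct, by irreflexivity) members are adjacent
isIndependent : (G : Graph) → Subset (order G) → Bool
isIndependent G S =
  and (map (λ u → and (map (λ v → not (lookup S u ∧ lookup S v ∧ adj G u v)) (allFin (order G))))
      (allFin (order G)))

-- polynomials with natural coefficients, as coefficient sequences
Poly : Set
Poly = ℕ → ℕ

I : Graph → Poly
I G k = length (filterᵇ (λ S → isIndependent G S ∧ (∣ S ∣ ≡ᵇ k)) (allSubsets (order G)))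

sumTo : ℕ → (ℕ → ℕ) → ℕ
sumTo zero    f = f 0
sumTo (suc k) f = sumTo k f + f (suc k)

_⊛_ : Poly → Poly → Poly
(p ⊛ q) k = sumTo k (λ j → p j * q (k ∸ j))

onePlusXPow : ℕ → Poly
onePlusXPow m j = m C j

-- Clique covers: a partition of V(G) into m (nonempty) cliques, given by
-- the map sending each vertex to the index of its clique.

record CliqueCover (G : Graph) (m : ℕ) : Set where
  field
    cls     : Fin (order G) → Fin m
    onto    : ∀ q → ∃ λ v → cls v ≡ q
    isCliq  : ∀ u v → cls u ≡ cls v → ¬ (u ≡ v) → adj G u v ≡ true
open CliqueCover public

-- Graph "G plus two new vertices per part": vertices are Fin n ⊎ Fin (m * 2);
-- the new vertex (q , t) (q : Fin m, t : Fin 2) is joined exactly to the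
-- old vertices v with c v ≡ q.

module Attach (G : Graph) {m : ℕ} (c : Fin (order G) → Fin m) where
  n = order G

  adjS : Fin n ⊎ Fin (m * 2) → Fin n ⊎ Fin (m * 2) → Bool
  adjS (inj₁ a) (inj₁ b) = adj G a b
  adjS (inj₁ a) (inj₂ p) = ⌊ c a ≟ proj₁ (remQuot 2 p) ⌋
  adjS (inj₂ p) (inj₁ a) = ⌊ c a ≟ proj₁ (remQuot 2 p) ⌋
  adjS (inj₂ p) (inj₂ q) = false

  adjS-sym : ∀ x y → adjS x y ≡ adjS y x
  adjS-sym (inj₁ a) (inj₁ b) = sym G a b
  adjS-sym (inj₁ a) (inj₂ p) = refl
  adjS-sym (inj₂ p) (inj₁ a) = refl
  adjS-sym (inj₂ p) (inj₂ q) = refl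

  adjS-irrefl : ∀ x → adjS x x ≡ false
  adjS-irrefl (inj₁ a) = irrefl G a
  adjS-irrefl (inj₂ p) = refl

  graph : Graph
  graph = record
    { order  = n + m * 2
    ; adj    = λ u v → adjS (splitAt n u) (splitAt n v)
    ; sym    = λ u v → adjS-sym (splitAt n u) (splitAt n v)
    ; irrefl = λ v → adjS-irrefl (splitAt n v)
    }

-- G ∘ 2K₁ : two new non-adjacent pendant vertices attached to each vertex v
-- (new vertex (v , t) adjacent only to v)
_∘2K₁ : Graph → Graph
G ∘2K₁ = Attach.graph G (λ v → v)

-- Φ(G) : two new non-adjacent vertices joined to all vertices of each clique Q ∈ Φ
ΦG : (G : Graph) {m : ℕ} → CliqueCover G m → Graph
ΦG G Φ = Attach.graph G (cls Φ)

module Submission where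

-- Both G ∘ 2K₁ and Φ(G) are instances of one construction (Defs.Attach):
-- for a map c : V(G) → Fin m, attach two new vertices to every part c⁻¹(q),
-- each joined to all of that part.  An independent set of the attached graph
-- is S ∪ T with S independent in G and T a set of new vertices whose part
-- misses S.  Summing over S therefore gives
--     I(Attach G c; x) = Σ_{S independent} x^|S| (1 + x)^(free_c S),
-- where free_c S = 2 · #{parts not met by S}.  For the identity map (G ∘ 2K₁)
-- S meets |S| of the n parts; for a clique cover an independent S meets each
-- clique at most once, hence again exactly |S| of the m parts.  So
-- free_id S = (2n − 2m) + free_Φ S, and Vandermonde's identity
-- (1 + x)^a (1 + x)^b = (1 + x)^(a+b) finishes the proof term by term.

open import Defs hiding (sym)
open import Algebra.Bundles using (CommutativeMonoid)
open import Data.Bool using (Bool; true; false; not; _∧_; _∨_; if_then_else_)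
open import Data.Bool.ListAction using (and)
open import Data.Bool.Properties using (∧-assoc; ∧-zeroʳ; not-injective; ∧-commutativeMonoid)
open import Data.Nat using (ℕ; zero; suc; _+_; _*_; _∸_; _≡ᵇ_; _≤_; z≤n)
open import Data.Nat.Properties
  using ( +-assoc; +-comm; +-suc; +-identityʳ; +-cancelʳ-≡; +-∸-assoc; *-zeroʳ; *-distribʳ-+
        ; *-distribˡ-+; *-distribˡ-∸; ≤-refl; m≤n⇒m≤1+n; n∸n≡0; m∸n+n≡m; +-commutativeSemigroup)
open import Data.Nat.Combinatorics using (_C_; nCk+nC[k+1]≡[n+1]C[k+1])
open import Data.Nat.Tactic.RingSolver using (solve-∀)
open import Data.Fin using (Fin; splitAt; quotient; _≟_; _↑ˡ_; _↑ʳ_) renaming (zero to fz; suc to fs)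
open import Data.Fin.Properties using (splitAt-↑ˡ; splitAt-↑ʳ; suc-injective; injective⇒≤)
open import Data.Fin.Subset using (Subset; ∣_∣; inside; outside)
open import Data.Vec using ([]; _∷_; lookup) renaming (_++_ to _++ᵛ_)
open import Data.Vec.Properties using (lookup-splitAt)
open import Data.List using (List; []; _∷_; _++_; map; length; filterᵇ; allFin; tabulate)
open import Data.List.Properties using (map-tabulate; map-++; map-∘; map-cong)
open import Data.Nat.ListAction using (sum)
open import Data.Nat.ListAction.Properties using (sum-++)
open import Data.Product using (proj₁; proj₂)
open import Data.Sum using (_⊎_; inj₁; inj₂; [_,_]′)
open import Function using (_∘_)
open import Relation.Nullary using (yes; no)
open import Relation.Nullary.Decidable using (⌊_⌋)
open import Relation.Binary.PropositionalEquality
open ≡-Reasoning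

open import Algebra.Properties.CommutativeSemigroup
  (CommutativeMonoid.commutativeSemigroup ∧-commutativeMonoid)
  using () renaming (interchange to ∧-interchange; x∙yz≈y∙xz to ∧-leftComm)
open import Algebra.Properties.CommutativeSemigroup +-commutativeSemigroup
  using () renaming (interchange to +-interchange)

ind : Bool → ℕ
ind true  = 1
ind false = 0

allB : ∀ {n} → (Fin n → Bool) → Bool
allB {zero}  f = true
allB {suc n} f = f fz ∧ allB (f ∘ fs)

anyB : ∀ {n} → (Fin n → Bool) → Bool
anyB {zero}  f = false
anyB {suc n} f = f fz ∨ anyB (f ∘ fs)

countB : ∀ {n} → (Fin n → Bool) → ℕ
countB {zero}  f = 0
countB {suc n} f = ind (f fz) + countB (f ∘ fs)

allB-cong : ∀ {n} {f g : Fin n → Bool} → f ≗ g → allB f ≡ allB g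
allB-cong {zero}  e = refl
allB-cong {suc n} e = cong₂ _∧_ (e fz) (allB-cong (e ∘ fs))

countB-cong : ∀ {n} {f g : Fin n → Bool} → f ≗ g → countB f ≡ countB g
countB-cong {zero}  e = refl
countB-cong {suc n} e = cong₂ _+_ (cong ind (e fz)) (countB-cong (e ∘ fs))

allB-true : ∀ {n} {f : Fin n → Bool} → (∀ i → f i ≡ true) → allB f ≡ true
allB-true {zero}  e = refl
allB-true {suc n} e rewrite e fz = allB-true (e ∘ fs)

allB-true⁻ : ∀ {n} {f : Fin n → Bool} → allB f ≡ true → ∀ i → f i ≡ true
allB-true⁻ {suc n} {f} e fz with f fz | e
... | true | _ = refl
allB-true⁻ {suc n} {f} e (fs i) with f fz | e
... | true | e′ = allB-true⁻ e′ i

anyB-false : ∀ {n} {f : Fin n → Bool} → (∀ i → f i ≡ false) → anyB f ≡ false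
anyB-false {zero}  e = refl
anyB-false {suc n} e rewrite e fz = anyB-false (e ∘ fs)

∧-absorb : ∀ a b → (a ∧ b) ∧ (b ∧ true) ≡ a ∧ b
∧-absorb true  true  = refl
∧-absorb true  false = refl
∧-absorb false b     = refl

allB-∧ : ∀ {n} (f g : Fin n → Bool) → allB (λ i → f i ∧ g i) ≡ allB f ∧ allB g
allB-∧ {zero}  f g = refl
allB-∧ {suc n} f g = trans (cong ((f fz ∧ g fz) ∧_) (allB-∧ (f ∘ fs) (g ∘ fs)))
                           (∧-interchange (f fz) (g fz) _ _)

allB-comm : ∀ {n k} (F : Fin n → Fin k → Bool) →
            allB (λ i → allB (F i)) ≡ allB (λ j → allB (λ i → F i j))
allB-comm {zero} {k} F = sym (allB-true {k} (λ _ → refl))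
allB-comm {suc n} F = trans (cong (allB (F fz) ∧_) (allB-comm (F ∘ fs)))
                            (sym (allB-∧ (F fz) (λ j → allB (λ i → F (fs i) j))))

not-∧-anyB : ∀ {n} x (g : Fin n → Bool) → not (x ∧ anyB g) ≡ allB (λ i → not (x ∧ g i))
not-∧-anyB {n} false g = sym (allB-true {n} (λ _ → refl))
not-∧-anyB {zero}  true g = refl
not-∧-anyB {suc n} true g with g fz
... | true  = refl
... | false = not-∧-anyB true (g ∘ fs)

allB-splitAt : ∀ n b (h : Fin n ⊎ Fin b → Bool) →
               allB (h ∘ splitAt n) ≡ allB (h ∘ inj₁) ∧ allB (h ∘ inj₂)
allB-splitAt n b h = trans (allB-++ n) (cong₂ _∧_ (allB-cong (cong h ∘ λ i → splitAt-↑ˡ n i b))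
                                                  (allB-cong (cong h ∘ splitAt-↑ʳ n b)))
  where
  allB-++ : ∀ n {f : Fin (n + b) → Bool} → allB f ≡ allB (λ i → f (i ↑ˡ b)) ∧ allB (λ j → f (n ↑ʳ j))
  allB-++ zero    = refl
  allB-++ (suc n) {f} = trans (cong (f fz ∧_) (allB-++ n)) (sym (∧-assoc (f fz) _ _))

and-allFin : ∀ n (f : Fin n → Bool) → and (map f (allFin n)) ≡ allB f
and-allFin n f = trans (cong and (map-tabulate (λ i → i) f)) (and-tabulate f)
  where
  and-tabulate : ∀ {n} (f : Fin n → Bool) → and (tabulate f) ≡ allB f
  and-tabulate {zero}  f = refl
  and-tabulate {suc n} f = cong (f fz ∧_) (and-tabulate (f ∘ fs))

countB-not : ∀ {n} (g : Fin n → Bool) → countB (not ∘ g) + countB g ≡ n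
countB-not {zero}  g = refl
countB-not {suc n} g with g fz
... | true  = trans (+-suc _ _) (cong suc (countB-not (g ∘ fs)))
... | false = cong suc (countB-not (g ∘ fs))

countB-quotient : ∀ m (h : Fin m → Bool) → countB {m * 2} (h ∘ quotient 2) ≡ 2 * countB h
countB-quotient zero    h = refl
countB-quotient (suc m) h = trans (cong (λ c → ind (h fz) + (ind (h fz) + c)) (countB-quotient m (h ∘ fs)))
                                  (doubling (ind (h fz)) (countB (h ∘ fs)))
  where
  doubling : ∀ a c → a + (a + 2 * c) ≡ 2 * (a + c)
  doubling = solve-∀

countB-insert : ∀ {m} (q₀ : Fin m) (h : Fin m → Bool) → h q₀ ≡ false →
                countB (λ q → ⌊ q₀ ≟ q ⌋ ∨ h q) ≡ suc (countB h)
countB-insert fz h e rewrite e = refl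
countB-insert (fs q₀) h e =
  trans (cong (ind (h fz) +_) (trans (countB-cong (λ q → cong (_∨ h (fs q)) (fs≟fs q)))
                                      (countB-insert q₀ (h ∘ fs) e)))
        (+-suc _ _)
  where
  fs≟fs : ∀ q → ⌊ fs q₀ ≟ fs q ⌋ ≡ ⌊ q₀ ≟ q ⌋
  fs≟fs q with q₀ ≟ q
  ... | yes _ = refl
  ... | no  _ = refl

meets : ∀ {n m} → (Fin n → Fin m) → Subset n → Fin m → Bool
meets c S q = anyB (λ i → lookup S i ∧ ⌊ c i ≟ q ⌋)

unmet : ∀ {n m} → (Fin n → Fin m) → Subset n → ℕ
unmet c S = countB (not ∘ meets c S)

InjectiveOn : ∀ {n m} → (Fin n → Fin m) → Subset n → Set
InjectiveOn c S = ∀ u v → lookup S u ≡ true → lookup S v ≡ true → c u ≡ c v → u ≡ v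

injectiveOn-tail : ∀ {n m x} {c : Fin (suc n) → Fin m} {S : Subset n} →
                   InjectiveOn c (x ∷ S) → InjectiveOn (c ∘ fs) S
injectiveOn-tail inj u v su sv e = suc-injective (inj (fs u) (fs v) su sv e)

countB-meets : ∀ {n m} (c : Fin n → Fin m) (S : Subset n) → InjectiveOn c S →
               countB (meets c S) ≡ ∣ S ∣
countB-meets {m = m} c [] inj = countB-false m
  where
  countB-false : ∀ m → countB {m} (λ _ → false) ≡ 0
  countB-false zero    = refl
  countB-false (suc m) = countB-false m
countB-meets c (outside ∷ S) inj = countB-meets (c ∘ fs) S (injectiveOn-tail inj)
countB-meets c (inside ∷ S) inj =
  trans (countB-insert (c fz) _ (anyB-false c-fresh))
        (cong suc (countB-meets (c ∘ fs) S (injectiveOn-tail inj)))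
  where
  c-fresh : ∀ i → (lookup S i ∧ ⌊ c (fs i) ≟ c fz ⌋) ≡ false
  c-fresh i with lookup S i in si
  ... | false = refl
  ... | true with c (fs i) ≟ c fz
  ...   | no  _ = refl
  ...   | yes e with inj (fs i) fz si refl e
  ...     | ()

isIndependent-allB : (G : Graph) (S : Subset (order G)) →
  isIndependent G S ≡ allB (λ u → allB (λ v → not (lookup S u ∧ lookup S v ∧ adj G u v)))
isIndependent-allB G S =
  trans (and-allFin (order G) _)
        (allB-cong (λ u → and-allFin (order G) (λ v → not (lookup S u ∧ lookup S v ∧ adj G u v))))

independent⇒nonadjacent : (G : Graph) (S : Subset (order G)) → isIndependent G S ≡ true →
  ∀ u v → lookup S u ≡ true → lookup S v ≡ true → adj G u v ≡ false
independent⇒nonadjacent G S ind u v su sv =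
  not-injective (trans (cong₂ (λ a b → not (a ∧ b ∧ adj G u v)) (sym su) (sym sv)) pair-ok)
  where
  pair-ok : not (lookup S u ∧ lookup S v ∧ adj G u v) ≡ true
  pair-ok = allB-true⁻ (allB-true⁻ (trans (sym (isIndependent-allB G S)) ind) u) v

count : ∀ {A : Set} → (A → Bool) → List A → ℕ
count P []       = 0
count P (x ∷ xs) = ind (P x) + count P xs

length-filterᵇ : ∀ {A : Set} (P : A → Bool) xs → length (filterᵇ P xs) ≡ count P xs
length-filterᵇ P []       = refl
length-filterᵇ P (x ∷ xs) with P x
... | true  = cong suc (length-filterᵇ P xs)
... | false = length-filterᵇ P xs

count-++ : ∀ {A : Set} (P : A → Bool) xs ys → count P (xs ++ ys) ≡ count P xs + count P ys
count-++ P []       ys = refl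
count-++ P (x ∷ xs) ys = trans (cong (ind (P x) +_) (count-++ P xs ys)) (sym (+-assoc (ind (P x)) _ _))

count-map : ∀ {A B : Set} (P : B → Bool) (f : A → B) xs → count P (map f xs) ≡ count (P ∘ f) xs
count-map P f []       = refl
count-map P f (x ∷ xs) = cong (ind (P (f x)) +_) (count-map P f xs)

count-cong : ∀ {A : Set} {P Q : A → Bool} xs → P ≗ Q → count P xs ≡ count Q xs
count-cong []       e = refl
count-cong (x ∷ xs) e = cong₂ _+_ (cong ind (e x)) (count-cong xs e)

count-false : ∀ {A : Set} xs → count {A} (λ _ → false) xs ≡ 0
count-false []       = refl
count-false (x ∷ xs) = count-false xs

sum-map-cong : ∀ {A : Set} {f g : A → ℕ} → f ≗ g → ∀ xs → sum (map f xs) ≡ sum (map g xs)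
sum-map-cong e xs = cong sum (map-cong e xs)

-- a subset of Fin (n + b) is S ++ T with S ⊆ Fin n and T ⊆ Fin b:
-- counting over subsets of Fin (n + b) is a double count
count-subsets-++ : ∀ n b (P : Subset (n + b) → Bool) →
  count P (allSubsets (n + b)) ≡ sum (map (λ S → count (P ∘ (S ++ᵛ_)) (allSubsets b)) (allSubsets n))
count-subsets-++ zero    b P = sym (+-identityʳ _)
count-subsets-++ (suc n) b P = begin
  count P (map (outside ∷_) (allSubsets (n + b)) ++ map (inside ∷_) (allSubsets (n + b)))
    ≡⟨ count-++ P (map (outside ∷_) (allSubsets (n + b))) _ ⟩
  count P (map (outside ∷_) (allSubsets (n + b))) + count P (map (inside ∷_) (allSubsets (n + b)))
    ≡⟨ cong₂ _+_ (trans (count-map P _ (allSubsets (n + b))) (count-subsets-++ n b _))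
                 (trans (count-map P _ (allSubsets (n + b))) (count-subsets-++ n b _)) ⟩
  sum (map (F ∘ (outside ∷_)) (allSubsets n)) + sum (map (F ∘ (inside ∷_)) (allSubsets n))
    ≡⟨ cong₂ _+_ (cong sum (map-∘ (allSubsets n))) (cong sum (map-∘ (allSubsets n))) ⟩
  sum (map F (map (outside ∷_) (allSubsets n))) + sum (map F (map (inside ∷_) (allSubsets n)))
    ≡⟨ sym (sum-++ (map F (map (outside ∷_) (allSubsets n))) _) ⟩
  sum (map F (map (outside ∷_) (allSubsets n)) ++ map F (map (inside ∷_) (allSubsets n)))
    ≡⟨ cong sum (sym (map-++ F (map (outside ∷_) (allSubsets n)) _)) ⟩
  sum (map F (allSubsets (suc n))) ∎
  where
  F : Subset (suc n) → ℕ
  F S = count (P ∘ (S ++ᵛ_)) (allSubsets b)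

size-++ : ∀ {n b} (S : Subset n) (T : Subset b) → ∣ S ++ᵛ T ∣ ≡ ∣ S ∣ + ∣ T ∣
size-++ []            T = refl
size-++ (outside ∷ S) T = size-++ S T
size-++ (inside ∷ S)  T = cong suc (size-++ S T)

shift1 : Poly → Poly
shift1 p zero    = 0
shift1 p (suc k) = p k

shift : ℕ → Poly → Poly
shift zero    p = p
shift (suc s) p = shift1 (shift s p)

sumTo-cong : ∀ k {f g : ℕ → ℕ} → (∀ j → j ≤ k → f j ≡ g j) → sumTo k f ≡ sumTo k g
sumTo-cong zero    e = e 0 z≤n
sumTo-cong (suc k) e = cong₂ _+_ (sumTo-cong k (λ j j≤k → e j (m≤n⇒m≤1+n j≤k))) (e (suc k) ≤-refl)

sumTo-+ : ∀ k (f g : ℕ → ℕ) → sumTo k (λ j → f j + g j) ≡ sumTo k f + sumTo k g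
sumTo-+ zero    f g = refl
sumTo-+ (suc k) f g = trans (cong (_+ (f (suc k) + g (suc k))) (sumTo-+ k f g))
                            (+-interchange (sumTo k f) (sumTo k g) (f (suc k)) (g (suc k)))

sumTo-suc : ∀ k (f : ℕ → ℕ) → sumTo (suc k) f ≡ f 0 + sumTo k (f ∘ suc)
sumTo-suc zero    f = refl
sumTo-suc (suc k) f = trans (cong (_+ f (suc (suc k))) (sumTo-suc k f)) (+-assoc (f 0) _ _)

sumTo-first : ∀ k (f : ℕ → ℕ) → (∀ j → f (suc j) ≡ 0) → sumTo k f ≡ f 0
sumTo-first zero    f e = refl
sumTo-first (suc k) f e = trans (cong₂ _+_ (sumTo-first k f e) (e k)) (+-identityʳ (f 0))

⊛-congˡ : ∀ {p p′ : Poly} (q : Poly) → p ≗ p′ → ∀ k → (p ⊛ q) k ≡ (p′ ⊛ q) k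
⊛-congˡ q e k = sumTo-cong k (λ j _ → cong (_* q (k ∸ j)) (e j))

⊛-congʳ : ∀ (p : Poly) {q q′ : Poly} → q ≗ q′ → ∀ k → (p ⊛ q) k ≡ (p ⊛ q′) k
⊛-congʳ p e k = sumTo-cong k (λ j _ → cong (p j *_) (e (k ∸ j)))

⊛-zeroʳ : ∀ (p : Poly) k → (p ⊛ (λ _ → 0)) k ≡ 0
⊛-zeroʳ p zero    = *-zeroʳ (p 0)
⊛-zeroʳ p (suc k) = cong₂ _+_ (⊛-zeroʳ p k) (*-zeroʳ (p (suc k)))

⊛-+ˡ : ∀ (p q r : Poly) k → ((λ j → p j + q j) ⊛ r) k ≡ (p ⊛ r) k + (q ⊛ r) k
⊛-+ˡ p q r k = trans (sumTo-cong k (λ j _ → *-distribʳ-+ (r (k ∸ j)) (p j) (q j))) (sumTo-+ k _ _)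

⊛-sumʳ : ∀ {A : Set} (p : Poly) (F : A → Poly) xs k →
         (p ⊛ (λ j → sum (map (λ x → F x j) xs))) k ≡ sum (map (λ x → (p ⊛ F x) k) xs)
⊛-sumʳ p F []       k = ⊛-zeroʳ p k
⊛-sumʳ p F (x ∷ xs) k =
  trans (sumTo-cong k (λ j _ → *-distribˡ-+ (p j) (F x (k ∸ j)) _))
        (trans (sumTo-+ k _ _) (cong ((p ⊛ F x) k +_) (⊛-sumʳ p F xs k)))

⊛-shift1ˡ : ∀ (p r : Poly) k → (shift1 p ⊛ r) k ≡ shift1 (p ⊛ r) k
⊛-shift1ˡ p r zero    = refl
⊛-shift1ˡ p r (suc k) = sumTo-suc k (λ j → shift1 p j * r (suc k ∸ j))

⊛-shift1ʳ : ∀ (p q : Poly) k → (p ⊛ shift1 q) k ≡ shift1 (p ⊛ q) k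
⊛-shift1ʳ p q zero    = *-zeroʳ (p 0)
⊛-shift1ʳ p q (suc k) = begin
  sumTo k (λ j → p j * shift1 q (suc k ∸ j)) + p (suc k) * shift1 q (suc k ∸ suc k)
    ≡⟨ cong₂ _+_ (sumTo-cong k (λ j j≤k → cong (λ i → p j * shift1 q i) (+-∸-assoc 1 j≤k)))
                 (cong (λ i → p (suc k) * shift1 q i) (n∸n≡0 k)) ⟩
  sumTo k (λ j → p j * q (k ∸ j)) + p (suc k) * 0
    ≡⟨ cong (sumTo k (λ j → p j * q (k ∸ j)) +_) (*-zeroʳ (p (suc k))) ⟩
  sumTo k (λ j → p j * q (k ∸ j)) + 0
    ≡⟨ +-identityʳ _ ⟩
  (p ⊛ q) k ∎

shift-cong : ∀ s {p q : Poly} → p ≗ q → ∀ k → shift s p k ≡ shift s q k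
shift-cong zero    e k       = e k
shift-cong (suc s) e zero    = refl
shift-cong (suc s) e (suc k) = shift-cong s e k

⊛-shiftʳ : ∀ s (p q : Poly) k → (p ⊛ shift s q) k ≡ shift s (p ⊛ q) k
⊛-shiftʳ zero    p q k       = refl
⊛-shiftʳ (suc s) p q zero    = ⊛-shift1ʳ p (shift s q) zero
⊛-shiftʳ (suc s) p q (suc k) = trans (⊛-shift1ʳ p (shift s q) (suc k)) (⊛-shiftʳ s p q k)

pascal : ∀ a j → suc a C j ≡ a C j + shift1 (a C_) j
pascal a zero    = refl
pascal a (suc j) = trans (sym (nCk+nC[k+1]≡[n+1]C[k+1] a j)) (+-comm (a C j) (a C suc j))

shift-pascal : ∀ s a k → shift s (a C_) k + shift (suc s) (a C_) k ≡ shift s (suc a C_) k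
shift-pascal zero    a zero    = refl
shift-pascal zero    a (suc k) = sym (pascal a (suc k))
shift-pascal (suc s) a zero    = refl
shift-pascal (suc s) a (suc k) = shift-pascal s a k

vandermonde : ∀ a b k → (onePlusXPow a ⊛ onePlusXPow b) k ≡ (a + b) C k
vandermonde zero    b k = trans (sumTo-first k _ (λ j → refl)) (+-identityʳ (b C k))
vandermonde (suc a) b k = begin
  (onePlusXPow (suc a) ⊛ onePlusXPow b) k
    ≡⟨ ⊛-congˡ (onePlusXPow b) (pascal a) k ⟩
  ((λ j → a C j + shift1 (a C_) j) ⊛ onePlusXPow b) k
    ≡⟨ ⊛-+ˡ (a C_) (shift1 (a C_)) (b C_) k ⟩
  (onePlusXPow a ⊛ onePlusXPow b) k + (shift1 (a C_) ⊛ onePlusXPow b) k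
    ≡⟨ cong₂ _+_ (vandermonde a b k) (trans (⊛-shift1ˡ (a C_) (b C_) k) (shifted k)) ⟩
  (a + b) C k + shift1 ((a + b) C_) k
    ≡⟨ sym (pascal (a + b) k) ⟩
  (suc a + b) C k ∎
  where
  shifted : ∀ k → shift1 (onePlusXPow a ⊛ onePlusXPow b) k ≡ shift1 ((a + b) C_) k
  shifted zero    = refl
  shifted (suc k) = vandermonde a b k

avoids : ∀ {b} → (Fin b → Bool) → Subset b → Bool
avoids g T = allB (λ p → not (lookup T p ∧ g p))

count-avoiding : ∀ b (g : Fin b → Bool) s k →
  count (λ T → avoids g T ∧ (s + ∣ T ∣ ≡ᵇ k)) (allSubsets b) ≡ shift s (countB (not ∘ g) C_) k
count-avoiding zero    g s k = monomial s k
  where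
  monomial : ∀ s k → ind (s + 0 ≡ᵇ k) + 0 ≡ shift s (0 C_) k
  monomial zero    zero    = refl
  monomial zero    (suc k) = refl
  monomial (suc s) zero    = refl
  monomial (suc s) (suc k) = monomial s k
count-avoiding (suc b) g s k =
  trans (count-++ P (map (outside ∷_) A) (map (inside ∷_) A))
        (trans (cong₂ _+_ (trans (count-map P (outside ∷_) A) (count-avoiding b g′ s k))
                          (count-map P (inside ∷_) A))
               (first-position (g fz) refl))
  where
  g′ : Fin b → Bool
  g′ = g ∘ fs
  A : List (Subset b)
  A = allSubsets b
  P : Subset (suc b) → Bool
  P T = avoids g T ∧ (s + ∣ T ∣ ≡ᵇ k)
  -- the subsets containing position 0 contribute nothing if it is forbidden,
  -- and x^(s+1) (1 + x)^#{allowed positions > 0} if it is allowed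
  first-position : ∀ x → g fz ≡ x →
    shift s (countB (not ∘ g′) C_) k + count (P ∘ (inside ∷_)) A ≡ shift s (countB (not ∘ g) C_) k
  first-position true  e rewrite e =
    trans (cong (shift s (countB (not ∘ g′) C_) k +_) (count-false A)) (+-identityʳ _)
  first-position false e rewrite e =
    trans (cong (shift s (countB (not ∘ g′) C_) k +_)
                (trans (count-cong A (λ T → cong (λ i → avoids g′ T ∧ (i ≡ᵇ k)) (+-suc s ∣ T ∣)))
                       (count-avoiding b g′ (suc s) k)))
          (shift-pascal s _ k)

module Attached (G : Graph) {m : ℕ} (c : Fin (order G) → Fin m) where
  open Attach G c using (graph; adjS)

  N : ℕ
  N = order G

  part : Fin (m * 2) → Fin m
  part = quotient 2

  blocked : Subset N → Fin (m * 2) → Bool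
  blocked S = meets c S ∘ part

  free : Subset N → ℕ
  free S = countB (not ∘ blocked S)

  -- each part carries two new vertices
  free≡2*unmet : ∀ S → free S ≡ 2 * unmet c S
  free≡2*unmet S = countB-quotient m (not ∘ meets c S)

  module Blocks (S : Subset N) (T : Subset (m * 2)) where
    L : Fin N ⊎ Fin (m * 2) → Bool
    L = [ lookup S , lookup T ]′

    H : Fin N ⊎ Fin (m * 2) → Fin N ⊎ Fin (m * 2) → Bool
    H x y = not (L x ∧ L y ∧ adjS x y)

    old-new new-old : Bool
    old-new = allB (λ i → allB (λ p → not (lookup S i ∧ lookup T p ∧ ⌊ c i ≟ part p ⌋)))
    new-old = allB (λ p → allB (λ i → not (lookup T p ∧ lookup S i ∧ ⌊ c i ≟ part p ⌋)))

    -- the old–old block is independence in G, and new vertices are pairwise non-adjacent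
    four-blocks : allB (λ u → allB (λ v → H (splitAt N u) (splitAt N v)))
                  ≡ (isIndependent G S ∧ old-new) ∧ (new-old ∧ true)
    four-blocks = begin
      allB (λ u → allB (λ v → H (splitAt N u) (splitAt N v)))
        ≡⟨ allB-cong (λ u → allB-splitAt N (m * 2) (H (splitAt N u))) ⟩
      allB (row ∘ splitAt N)
        ≡⟨ allB-splitAt N (m * 2) row ⟩
      allB (row ∘ inj₁) ∧ allB (row ∘ inj₂)
        ≡⟨ cong₂ _∧_ (allB-∧ (λ i → allB (H (inj₁ i) ∘ inj₁)) (λ i → allB (H (inj₁ i) ∘ inj₂)))
                     (allB-∧ (λ p → allB (H (inj₂ p) ∘ inj₁)) (λ p → allB (H (inj₂ p) ∘ inj₂))) ⟩
      (allB (λ i → allB (H (inj₁ i) ∘ inj₁)) ∧ old-new) ∧ (new-old ∧ allB (λ p → allB (H (inj₂ p) ∘ inj₂)))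
        ≡⟨ cong₂ (λ a b → (a ∧ old-new) ∧ (new-old ∧ b))
                 (sym (isIndependent-allB G S)) (allB-true (λ p → allB-true (λ q → new-new p q))) ⟩
      (isIndependent G S ∧ old-new) ∧ (new-old ∧ true) ∎
      where
      row : Fin N ⊎ Fin (m * 2) → Bool
      row x = allB (H x ∘ inj₁) ∧ allB (H x ∘ inj₂)
      new-new : ∀ p q → H (inj₂ p) (inj₂ q) ≡ true
      new-new p q = cong not (trans (cong (lookup T p ∧_) (∧-zeroʳ (lookup T q))) (∧-zeroʳ (lookup T p)))

    -- adjacency between old and new vertices is symmetric
    old-new≡new-old : old-new ≡ new-old
    old-new≡new-old = trans (allB-comm (λ i p → not (lookup S i ∧ lookup T p ∧ ⌊ c i ≟ part p ⌋)))
      (allB-cong (λ p → allB-cong (λ i → cong not (∧-leftComm (lookup S i) (lookup T p) _))))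

    new-old≡avoids : new-old ≡ avoids (blocked S) T
    new-old≡avoids = allB-cong (λ p → sym (not-∧-anyB (lookup T p) (λ i → lookup S i ∧ ⌊ c i ≟ part p ⌋)))

  independent-++ : ∀ S T → isIndependent graph (S ++ᵛ T) ≡ isIndependent G S ∧ avoids (blocked S) T
  independent-++ S T = begin
    isIndependent graph (S ++ᵛ T)
      ≡⟨ isIndependent-allB graph (S ++ᵛ T) ⟩
    allB (λ u → allB (λ v → not (lookup (S ++ᵛ T) u ∧ lookup (S ++ᵛ T) v ∧ adjS (splitAt N u) (splitAt N v))))
      ≡⟨ allB-cong (λ u → allB-cong (λ v → cong₂ (λ a b → not (a ∧ b ∧ adjS (splitAt N u) (splitAt N v)))
                                                 (lookup-splitAt N S T u) (lookup-splitAt N S T v))) ⟩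
    allB (λ u → allB (λ v → H (splitAt N u) (splitAt N v)))
      ≡⟨ four-blocks ⟩
    (isIndependent G S ∧ old-new) ∧ (new-old ∧ true)
      ≡⟨ cong (λ b → (isIndependent G S ∧ b) ∧ (new-old ∧ true)) old-new≡new-old ⟩
    (isIndependent G S ∧ new-old) ∧ (new-old ∧ true)
      ≡⟨ ∧-absorb (isIndependent G S) new-old ⟩
    isIndependent G S ∧ new-old
      ≡⟨ cong (isIndependent G S ∧_) new-old≡avoids ⟩
    isIndependent G S ∧ avoids (blocked S) T ∎
    where open Blocks S T

  term : Subset N → Poly
  term S k = if isIndependent G S then shift ∣ S ∣ (free S C_) k else 0

  I-attached : ∀ k → I graph k ≡ sum (map (λ S → term S k) (allSubsets N))
  I-attached k = begin
    I graph k
      ≡⟨ length-filterᵇ P (allSubsets (N + m * 2)) ⟩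
    count P (allSubsets (N + m * 2))
      ≡⟨ count-subsets-++ N (m * 2) P ⟩
    sum (map (λ S → count (P ∘ (S ++ᵛ_)) (allSubsets (m * 2))) (allSubsets N))
      ≡⟨ sum-map-cong count-extensions (allSubsets N) ⟩
    sum (map (λ S → term S k) (allSubsets N)) ∎
    where
    P : Subset (N + m * 2) → Bool
    P X = isIndependent graph X ∧ (∣ X ∣ ≡ᵇ k)
    A : List (Subset (m * 2))
    A = allSubsets (m * 2)
    count-extensions : ∀ S → count (P ∘ (S ++ᵛ_)) A ≡ term S k
    count-extensions S =
      trans (count-cong A (λ T → cong₂ (λ a b → a ∧ (b ≡ᵇ k)) (independent-++ S T) (size-++ S T)))
            (by-status (isIndependent G S))
      where
      by-status : ∀ x → count (λ T → (x ∧ avoids (blocked S) T) ∧ (∣ S ∣ + ∣ T ∣ ≡ᵇ k)) A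
                        ≡ (if x then shift ∣ S ∣ (free S C_) k else 0)
      by-status true  = count-avoiding (m * 2) (blocked S) ∣ S ∣ k
      by-status false = count-false A

unmet+size : ∀ {n m} (c : Fin n → Fin m) (S : Subset n) → InjectiveOn c S → unmet c S + ∣ S ∣ ≡ m
unmet+size c S inj = trans (cong (unmet c S +_) (sym (countB-meets c S inj)))
                           (countB-not (meets c S))

independent⇒injectiveOn : (G : Graph) {m : ℕ} (Φ : CliqueCover G m) (S : Subset (order G)) →
                          isIndependent G S ≡ true → InjectiveOn (cls Φ) S
independent⇒injectiveOn G Φ S ind u v su sv same with u ≟ v
... | yes u≡v = u≡v
... | no  u≢v with trans (sym (isCliq Φ u v same u≢v)) (independent⇒nonadjacent G S ind u v su sv)
...   | ()

-- the cliques of a cover are nonempty and disjoint, so there are at most n of them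
cover-size≤order : (G : Graph) {m : ℕ} (Φ : CliqueCover G m) → m ≤ order G
cover-size≤order G Φ = injective⇒≤ {f = representative} representative-injective
  where
  representative : _ → Fin (order G)
  representative q = proj₁ (onto Φ q)
  representative-injective : ∀ {q q′} → representative q ≡ representative q′ → q ≡ q′
  representative-injective {q} {q′} e =
    trans (sym (proj₂ (onto Φ q))) (trans (cong (cls Φ) e) (proj₂ (onto Φ q′)))

double-excess : ∀ f₁ f₂ {s N m} → f₁ + s ≡ N → f₂ + s ≡ m → m ≤ N → 2 * f₁ ≡ (2 * N ∸ 2 * m) + 2 * f₂
double-excess f₁ f₂ {s} {N} {m} e₁ e₂ m≤N = begin
  2 * f₁              ≡⟨ cong (2 *_) f₁≡e+f₂ ⟩
  2 * (e + f₂)        ≡⟨ *-distribˡ-+ 2 e f₂ ⟩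
  2 * e + 2 * f₂      ≡⟨ cong (_+ 2 * f₂) (*-distribˡ-∸ 2 N m) ⟩
  (2 * N ∸ 2 * m) + 2 * f₂ ∎
  where
  e : ℕ
  e = N ∸ m
  f₁≡e+f₂ : f₁ ≡ e + f₂
  f₁≡e+f₂ = +-cancelʳ-≡ s f₁ (e + f₂) (begin
    f₁ + s        ≡⟨ e₁ ⟩
    N             ≡⟨ sym (m∸n+n≡m m≤N) ⟩
    e + m         ≡⟨ cong (e +_) (sym e₂) ⟩
    e + (f₂ + s)  ≡⟨ sym (+-assoc e f₂ s) ⟩
    e + f₂ + s    ∎)

free-difference : (G : Graph) (m : ℕ) (Φ : CliqueCover G m) (S : Subset (order G)) →
  isIndependent G S ≡ true →
  Attached.free G (λ v → v) S ≡ (2 * order G ∸ 2 * m) + Attached.free G (cls Φ) S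
free-difference G m Φ S ind = begin
  Pendant.free S                   ≡⟨ Pendant.free≡2*unmet S ⟩
  2 * unmet (λ v → v) S            ≡⟨ double-excess (unmet (λ v → v) S) (unmet (cls Φ) S)
                                         (unmet+size (λ v → v) S (λ _ _ _ _ e → e))
                                         (unmet+size (cls Φ) S (independent⇒injectiveOn G Φ S ind))
                                         (cover-size≤order G Φ) ⟩
  d + 2 * unmet (cls Φ) S          ≡⟨ cong (d +_) (sym (Cover.free≡2*unmet S)) ⟩
  d + Cover.free S                 ∎
  where
  module Pendant = Attached G (λ v → v)
  module Cover   = Attached G (cls Φ)
  d : ℕ
  d = 2 * order G ∸ 2 * m

term-identity : (G : Graph) (m : ℕ) (Φ : CliqueCover G m) (S : Subset (order G)) (k : ℕ) →
  (onePlusXPow (2 * order G ∸ 2 * m) ⊛ Attached.term G (cls Φ) S) k ≡ Attached.term G (λ v → v) S k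
term-identity G m Φ S k with isIndependent G S in ind
... | false = ⊛-zeroʳ (onePlusXPow (2 * order G ∸ 2 * m)) k
... | true  = begin
  (onePlusXPow d ⊛ shift s (Cover.free S C_)) k    ≡⟨ ⊛-shiftʳ s (onePlusXPow d) _ k ⟩
  shift s (onePlusXPow d ⊛ (Cover.free S C_)) k   ≡⟨ shift-cong s (vandermonde d (Cover.free S)) k ⟩
  shift s ((d + Cover.free S) C_) k               ≡⟨ cong (λ a → shift s (a C_) k) (sym (free-difference G m Φ S ind)) ⟩
  shift s (Pendant.free S C_) k                   ∎
  where
  module Pendant = Attached G (λ v → v)
  module Cover   = Attached G (cls Φ)
  d : ℕ
  d = 2 * order G ∸ 2 * m
  s : ℕ
  s = ∣ S ∣

theorem9 : (G : Graph) (m : ℕ) (Φ : CliqueCover G m) (k : ℕ) →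
           I (G ∘2K₁) k ≡ (onePlusXPow (2 * order G ∸ 2 * m) ⊛ I (ΦG G Φ)) k
theorem9 G m Φ k = begin
  I (G ∘2K₁) k
    ≡⟨ Pendant.I-attached k ⟩
  sum (map (λ S → Pendant.term S k) subsets)
    ≡⟨ sum-map-cong (λ S → sym (term-identity G m Φ S k)) subsets ⟩
  sum (map (λ S → (onePlusXPow d ⊛ Cover.term S) k) subsets)
    ≡⟨ sym (⊛-sumʳ (onePlusXPow d) Cover.term subsets k) ⟩
  (onePlusXPow d ⊛ (λ j → sum (map (λ S → Cover.term S j) subsets))) k
    ≡⟨ ⊛-congʳ (onePlusXPow d) (λ j → sym (Cover.I-attached j)) k ⟩
  (onePlusXPow d ⊛ I (ΦG G Φ)) k ∎
  where
  module Pendant = Attached G (λ v → v)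
  module Cover   = Attached G (cls Φ)
  d : ℕ
  d = 2 * order G ∸ 2 * m
  subsets : List (Subset (order G))
  subsets = allSubsets (order G)
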